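{- Let $M$ be a $3$-connected matroid. Let $X \subseteq E(M)$ be such that $\lambda(X) = 2$, $|X| \geq 3$ and $|E(M)| \geq |X| + 4$. If $e \in \mathrm{cl}(X)-X$, then either $e$ is contained in a triad of $M$, or $M \backslash e$ is $3$-connected.
   Context: $\lambda(X)=r(X)+r(E(M)-X)-r(M)$; $\mathrm{cl}$ is the closure operator of $M$; a triad is a 3-element cocircuit. -}

module Defs where

open import Data.Nat using (ℕ; _+_; _∸_; _≤_; _<_)
open import Data.Fin using (Fin)
open import Data.Fin.Subset using (Subset; _∈_; _∉_; _⊆_; _⊂_; _∪_; _∩_; _─_; _-_; ⁅_⁆; ∣_∣)
open import Data.Product using (_×_; ∃-syntax)
open import Relation.Nullary using (¬_)
open import Relation.Binary.PropositionalEquality using (_≡_)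

-- A (finite) matroid whose ground set E is a subset of Fin n, given by
-- its rank function r (Oxley's rank axioms R1-R3, for subsets of E).
-- Values of r on sets not contained in E are irrelevant.
record Matroid (n : ℕ) : Set where
  field
    E : Subset n
    r : Subset n → ℕ
    r-card   : ∀ X → X ⊆ E → r X ≤ ∣ X ∣
    r-mono   : ∀ X Y → X ⊆ E → Y ⊆ E → X ⊆ Y → r X ≤ r Y
    r-submod : ∀ X Y → X ⊆ E → Y ⊆ E → r (X ∪ Y) + r (X ∩ Y) ≤ r X + r Y

module _ {n : ℕ} where

  -- Connectivity function on ground set E with rank r:
  -- λ(X) = r(X) + r(E - X) - r(E)  (nonnegative by submodularity).
  conn : Subset n → (Subset n → ℕ) → Subset n → ℕ
  conn E r X = (r X + r (E ─ X)) ∸ r E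

  IsSeparation : Subset n → (Subset n → ℕ) → ℕ → Subset n → Set
  IsSeparation E r k X =
    X ⊆ E × k ≤ ∣ X ∣ × k ≤ ∣ E ─ X ∣ × conn E r X < k

  ThreeConnectedOn : Subset n → (Subset n → ℕ) → Set
  ThreeConnectedOn E r = ∀ k X → 1 ≤ k → k < 3 → ¬ IsSeparation E r k X

  DependentOn : Subset n → (Subset n → ℕ) → Subset n → Set
  DependentOn E r X = X ⊆ E × r X < ∣ X ∣

  CircuitOn : Subset n → (Subset n → ℕ) → Subset n → Set
  CircuitOn E r C = DependentOn E r C × (∀ Y → Y ⊂ C → ¬ DependentOn E r Y)

module _ {n : ℕ} (M : Matroid n) where
  open Matroid M

  λM : Subset n → ℕ
  λM = conn E r

  ThreeConnected : Set
  ThreeConnected = ThreeConnectedOn E r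

  dualRank : Subset n → ℕ
  dualRank X = (∣ X ∣ + r (E ─ X)) ∸ r E

  Cocircuit : Subset n → Set
  Cocircuit = CircuitOn E dualRank

  Triad : Subset n → Set
  Triad C = Cocircuit C × ∣ C ∣ ≡ 3

  _∈cl_ : Fin n → Subset n → Set
  e ∈cl X = e ∈ E × r (X ∪ ⁅ e ⁆) ≡ r X

  DeletionThreeConnected : Fin n → Set
  DeletionThreeConnected e = ThreeConnectedOn (E - e) r

-- Write F = E - e and Y = F - X. Since e ∈ cl(X) and λ(X) = 2, 3-connectivity of M forces
-- e ∈ cl(Y) too. Hence if Q ⊆ F has at least two elements and its complement in F contains X or
-- Y, then e is spanned by F - Q, so λ_{M\e}(Q) = λ_M(Q) ≥ 2. Uncrossing a separation (A, F - A)
-- of M \ e with λ ≤ 1 against (X, Y) by submodularity of λ, two opposite quadrants cannot both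
-- have two elements; as |X|, |Y| ≥ 3 this leaves a side S of the separation with |S| ≤ 2.
-- Then E - (S ∪ e) = F - S is non-spanning, and in a 3-connected matroid a set of size at most
-- three with non-spanning complement is a triad.
module Submission where

open import Algebra.Properties.CommutativeSemigroup using (interchange)
open import Data.Bool.Properties using (∧-idem; ∧-zeroʳ; ∨-idem; ∨-identityʳ)
open import Data.Empty using (⊥-elim)
open import Data.Fin using (Fin)
open import Data.Fin.Subset
open import Data.Fin.Subset.Properties
open import Data.Nat using (ℕ; suc; _+_; _≤_; _<_; _≤?_; _<?_; z≤n; s≤s; >-nonZero)
open import Data.Nat.Properties
open import Data.Product using (_×_; _,_; ∃-syntax)
open import Data.Sum using (_⊎_; inj₁; inj₂; [_,_]′; map₁; map₂)
open import Data.Vec using (_∷_; []; here; there)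
open import Relation.Nullary using (¬_; yes; no; Dec; contradiction)
open import Relation.Nullary.Decidable using (_×-dec_; _⊎-dec_)
open import Function using (_∘_)
open import Relation.Binary.PropositionalEquality

open import Defs

private variable
  n : ℕ

∣p∪q∣≤∣p∣+∣q∣ : ∀ (p q : Subset n) → ∣ p ∪ q ∣ ≤ ∣ p ∣ + ∣ q ∣
∣p∪q∣≤∣p∣+∣q∣ []            []            = z≤n
∣p∪q∣≤∣p∣+∣q∣ (inside  ∷ p) (inside  ∷ q) =
  s≤s (≤-trans (∣p∪q∣≤∣p∣+∣q∣ p q) (+-monoʳ-≤ ∣ p ∣ (n≤1+n ∣ q ∣)))
∣p∪q∣≤∣p∣+∣q∣ (inside  ∷ p) (outside ∷ q) = s≤s (∣p∪q∣≤∣p∣+∣q∣ p q)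
∣p∪q∣≤∣p∣+∣q∣ (outside ∷ p) (inside  ∷ q) =
  subst (∣ (outside ∷ p) ∪ (inside ∷ q) ∣ ≤_) (sym (+-suc ∣ p ∣ ∣ q ∣)) (s≤s (∣p∪q∣≤∣p∣+∣q∣ p q))
∣p∪q∣≤∣p∣+∣q∣ (outside ∷ p) (outside ∷ q) = ∣p∪q∣≤∣p∣+∣q∣ p q

∪-lub : ∀ {p q t : Subset n} → p ⊆ t → q ⊆ t → p ∪ q ⊆ t
∪-lub {p = p} {q = q} p⊆t q⊆t x∈p∪q = [ p⊆t , q⊆t ]′ (x∈p∪q⁻ p q x∈p∪q)

∪-monoʳ-⊆ : ∀ {p q t : Subset n} → q ⊆ t → p ∪ q ⊆ p ∪ t
∪-monoʳ-⊆ {p = p} {q = q} q⊆t x∈p∪q = x∈p∪q⁺ (map₂ q⊆t (x∈p∪q⁻ p q x∈p∪q))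

x∈p⇒⁅x⁆⊆p : ∀ {p} {x : Fin n} → x ∈ p → ⁅ x ⁆ ⊆ p
x∈p⇒⁅x⁆⊆p {p = p} {x = x} x∈p y∈⁅x⁆ = subst (_∈ p) (sym (x∈⁅y⁆⇒x≡y x y∈⁅x⁆)) x∈p

x∈p─q⇒x∉q : ∀ {x : Fin n} (p q : Subset n) → x ∈ p ─ q → x ∉ q
x∈p─q⇒x∉q (inside ∷ p) (outside ∷ q) here         ()
x∈p─q⇒x∉q (_      ∷ p) (_       ∷ q) (there x∈p─q) (there x∈q) = x∈p─q⇒x∉q p q x∈p─q x∈q

p⊆q∧x∉p⇒p⊆q-x : ∀ {p q} {x : Fin n} → p ⊆ q → x ∉ p → p ⊆ q - x
p⊆q∧x∉p⇒p⊆q-x {p = p} {x = x} p⊆q x∉p y∈p =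
  x∈p∧x∉q⇒x∈p─q (p⊆q y∈p) (λ y∈⁅x⁆ → x∉p (subst (_∈ p) (x∈⁅y⁆⇒x≡y x y∈⁅x⁆) y∈p))

p⊆q-x⇒x∉p : ∀ {p q} {x : Fin n} → p ⊆ q - x → x ∉ p
p⊆q-x⇒x∉p {q = q} {x = x} p⊆q-x x∈p = x∈p─q⇒x∉q q ⁅ x ⁆ (p⊆q-x x∈p) (x∈⁅x⁆ x)

─-monoˡ-⊆ : ∀ {p q t : Subset n} → p ⊆ q → p ─ t ⊆ q ─ t
─-monoˡ-⊆ {p = p} {t = t} p⊆q x∈p─t = x∈p∧x∉q⇒x∈p─q (p⊆q (p─q⊆p p t x∈p─t)) (x∈p─q⇒x∉q p t x∈p─t)

─-monoʳ-⊆ : ∀ {p q t : Subset n} → t ⊆ q → p ─ q ⊆ p ─ t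
─-monoʳ-⊆ {p = p} {q = q} t⊆q x∈p─q = x∈p∧x∉q⇒x∈p─q (p─q⊆p p q x∈p─q) (x∈p─q⇒x∉q p q x∈p─q ∘ t⊆q)

p⊆[p─q]∪q : ∀ (p q : Subset n) → p ⊆ (p ─ q) ∪ q
p⊆[p─q]∪q p q {x} x∈p with x ∈? q
... | yes x∈q = x∈p∪q⁺ (inj₂ x∈q)
... | no  x∉q = x∈p∪q⁺ (inj₁ (x∈p∧x∉q⇒x∈p─q x∈p x∉q))

∣p∣≤∣p─q∣+∣q∣ : ∀ (p q : Subset n) → ∣ p ∣ ≤ ∣ p ─ q ∣ + ∣ q ∣
∣p∣≤∣p─q∣+∣q∣ p q = ≤-trans (p⊆q⇒∣p∣≤∣q∣ (p⊆[p─q]∪q p q)) (∣p∪q∣≤∣p∣+∣q∣ (p ─ q) q)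

∣p∣≤∣p∩q∣+∣p∩[t─q]∣ : ∀ {p q t : Subset n} → p ⊆ t → ∣ p ∣ ≤ ∣ p ∩ q ∣ + ∣ p ∩ (t ─ q) ∣
∣p∣≤∣p∩q∣+∣p∩[t─q]∣ {p = p} {q = q} {t = t} p⊆t =
  ≤-trans (p⊆q⇒∣p∣≤∣q∣ split) (∣p∪q∣≤∣p∣+∣q∣ (p ∩ q) (p ∩ (t ─ q)))
  where
  split : p ⊆ (p ∩ q) ∪ (p ∩ (t ─ q))
  split {x} x∈p with x ∈? q
  ... | yes x∈q = x∈p∪q⁺ (inj₁ (x∈p∩q⁺ (x∈p , x∈q)))
  ... | no  x∉q = x∈p∪q⁺ (inj₂ (x∈p∩q⁺ (x∈p , x∈p∧x∉q⇒x∈p─q (p⊆t x∈p) x∉q)))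

p─[p─q]≡q : ∀ {p q : Subset n} → q ⊆ p → p ─ (p ─ q) ≡ q
p─[p─q]≡q {p = []}          {q = []}          _   = refl
p─[p─q]≡q {p = inside  ∷ p} {q = inside  ∷ q} q⊆p = cong (inside  ∷_) (p─[p─q]≡q (drop-∷-⊆ q⊆p))
p─[p─q]≡q {p = inside  ∷ p} {q = outside ∷ q} q⊆p = cong (outside ∷_) (p─[p─q]≡q (drop-∷-⊆ q⊆p))
p─[p─q]≡q {p = outside ∷ p} {q = outside ∷ q} q⊆p = cong (outside ∷_) (p─[p─q]≡q (drop-∷-⊆ q⊆p))
p─[p─q]≡q {p = outside ∷ p} {q = inside  ∷ q} q⊆p = contradiction (q⊆p here) λ ()

p─[q∪t]≡[p─q]∩[p─t] : ∀ (p q t : Subset n) → p ─ (q ∪ t) ≡ (p ─ q) ∩ (p ─ t)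
p─[q∪t]≡[p─q]∩[p─t] []      []            []            = refl
p─[q∪t]≡[p─q]∩[p─t] (x ∷ p) (outside ∷ q) (outside ∷ t) =
  cong₂ _∷_ (sym (∧-idem x)) (p─[q∪t]≡[p─q]∩[p─t] p q t)
p─[q∪t]≡[p─q]∩[p─t] (x ∷ p) (outside ∷ q) (inside  ∷ t) =
  cong₂ _∷_ (sym (∧-zeroʳ x)) (p─[q∪t]≡[p─q]∩[p─t] p q t)
p─[q∪t]≡[p─q]∩[p─t] (x ∷ p) (inside  ∷ q) (_       ∷ t) =
  cong (outside ∷_) (p─[q∪t]≡[p─q]∩[p─t] p q t)

p─[q∩t]≡[p─q]∪[p─t] : ∀ (p q t : Subset n) → p ─ (q ∩ t) ≡ (p ─ q) ∪ (p ─ t)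
p─[q∩t]≡[p─q]∪[p─t] []      []            []            = refl
p─[q∩t]≡[p─q]∪[p─t] (x ∷ p) (outside ∷ q) (outside ∷ t) =
  cong₂ _∷_ (sym (∨-idem x)) (p─[q∩t]≡[p─q]∪[p─t] p q t)
p─[q∩t]≡[p─q]∪[p─t] (x ∷ p) (outside ∷ q) (inside  ∷ t) =
  cong₂ _∷_ (sym (∨-identityʳ x)) (p─[q∩t]≡[p─q]∪[p─t] p q t)
p─[q∩t]≡[p─q]∪[p─t] (x ∷ p) (inside  ∷ q) (_       ∷ t) = cong (_ ∷_) (p─[q∩t]≡[p─q]∪[p─t] p q t)

∣q∣+[1+k]≤∣p∣⇒k≤∣p-x─q∣ : ∀ (p q : Subset n) x {k} → ∣ q ∣ + suc k ≤ ∣ p ∣ → k ≤ ∣ p - x ─ q ∣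
∣q∣+[1+k]≤∣p∣⇒k≤∣p-x─q∣ p q x {k} q+1+k≤p = +-cancelˡ-≤ (∣ q ∣) k (∣ p - x ─ q ∣) (≤-pred (begin
  suc (∣ q ∣ + k)              ≡⟨ +-suc ∣ q ∣ k ⟨
  ∣ q ∣ + suc k                ≤⟨ q+1+k≤p ⟩
  ∣ p ∣                        ≤⟨ ∣p∣≤∣p─q∣+∣q∣ p ⁅ x ⁆ ⟩
  ∣ p - x ∣ + ∣ ⁅ x ⁆ ∣        ≡⟨ cong (∣ p - x ∣ +_) (∣⁅x⁆∣≡1 x) ⟩
  ∣ p - x ∣ + 1                ≤⟨ +-monoˡ-≤ 1 (∣p∣≤∣p─q∣+∣q∣ (p - x) q) ⟩
  ∣ p - x ─ q ∣ + ∣ q ∣ + 1    ≡⟨ +-comm (∣ p - x ─ q ∣ + ∣ q ∣) 1 ⟩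
  suc (∣ p - x ─ q ∣ + ∣ q ∣)  ≡⟨ cong suc (+-comm ∣ p - x ─ q ∣ ∣ q ∣) ⟩
  suc (∣ q ∣ + ∣ p - x ─ q ∣)  ∎))
  where open ≤-Reasoning

isSeparation? : ∀ (G : Subset n) ρ k A → Dec (IsSeparation G ρ k A)
isSeparation? G ρ k A = A ⊆? G ×-dec k ≤? ∣ A ∣ ×-dec k ≤? ∣ G ─ A ∣ ×-dec conn G ρ A <? k

separation⊎threeConnected : ∀ (G : Subset n) ρ →
  (∃[ k ] ∃[ A ] (1 ≤ k × k < 3 × IsSeparation G ρ k A)) ⊎ ThreeConnectedOn G ρ
separation⊎threeConnected G ρ
  with anySubset? (λ A → isSeparation? G ρ 1 A ⊎-dec isSeparation? G ρ 2 A)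
... | yes (A , inj₁ sep) = inj₁ (1 , A , ≤-refl , s≤s (s≤s z≤n) , sep)
... | yes (A , inj₂ sep) = inj₁ (2 , A , s≤s z≤n , ≤-refl , sep)
... | no  ¬sep = inj₂ λ where
  1 A _ _ sep → ¬sep (A , inj₁ sep)
  2 A _ _ sep → ¬sep (A , inj₂ sep)
  (suc (suc (suc _))) _ _ (s≤s (s≤s (s≤s ()))) _

module _ {n : ℕ} (M : Matroid n) where
  open Matroid M

  r-mono-⊆ : ∀ {A B} → A ⊆ B → B ⊆ E → r A ≤ r B
  r-mono-⊆ {A} {B} A⊆B B⊆E = r-mono A B (⊆-trans A⊆B B⊆E) B⊆E A⊆B

  -- λ⁺ G S is λ(S) + r(G) computed in M | G; it avoids the truncated subtraction in conn.
  λ⁺ : Subset n → Subset n → ℕ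
  λ⁺ G S = r S + r (G ─ S)

  λ⁺≤r+conn : ∀ G S → λ⁺ G S ≤ r G + conn G r S
  λ⁺≤r+conn G S = m≤n+m∸n (λ⁺ G S) (r G)

  λ⁺-monoˡ : ∀ {G H} S → G ⊆ H → H ⊆ E → λ⁺ G S ≤ λ⁺ H S
  λ⁺-monoˡ S G⊆H H⊆E = +-monoʳ-≤ (r S) (r-mono-⊆ (─-monoˡ-⊆ G⊆H) (⊆-trans (p─q⊆p _ S) H⊆E))

  λ⁺-complement : ∀ {G S} → S ⊆ G → λ⁺ G (G ─ S) ≡ λ⁺ G S
  λ⁺-complement {G} {S} S⊆G rewrite p─[p─q]≡q S⊆G = +-comm (r (G ─ S)) (r S)

  λ⁺-uncross : ∀ {G Z A} → G ⊆ E → Z ⊆ G → A ⊆ G →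
               λ⁺ G (Z ∩ A) + λ⁺ G (Z ∪ A) ≤ λ⁺ G Z + λ⁺ G A
  λ⁺-uncross {G} {Z} {A} G⊆E Z⊆G A⊆G = begin
    (r (Z ∩ A) + r (G ─ Z ∩ A)) + (r (Z ∪ A) + r (G ─ (Z ∪ A)))
      ≡⟨ cong₂ (λ U I → (r (Z ∩ A) + r U) + (r (Z ∪ A) + r I))
           (p─[q∩t]≡[p─q]∪[p─t] G Z A) (p─[q∪t]≡[p─q]∩[p─t] G Z A) ⟩
    (r (Z ∩ A) + r (Gᶻ ∪ Gᴬ)) + (r (Z ∪ A) + r (Gᶻ ∩ Gᴬ))
      ≡⟨ interchange +-commutativeSemigroup (r (Z ∩ A)) (r (Gᶻ ∪ Gᴬ)) (r (Z ∪ A)) (r (Gᶻ ∩ Gᴬ)) ⟩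
    (r (Z ∩ A) + r (Z ∪ A)) + (r (Gᶻ ∪ Gᴬ) + r (Gᶻ ∩ Gᴬ))
      ≡⟨ cong (_+ (r (Gᶻ ∪ Gᴬ) + r (Gᶻ ∩ Gᴬ))) (+-comm (r (Z ∩ A)) (r (Z ∪ A))) ⟩
    (r (Z ∪ A) + r (Z ∩ A)) + (r (Gᶻ ∪ Gᴬ) + r (Gᶻ ∩ Gᴬ))
      ≤⟨ +-mono-≤ (r-submod Z A (⊆-trans Z⊆G G⊆E) (⊆-trans A⊆G G⊆E))
                  (r-submod Gᶻ Gᴬ (⊆-trans (p─q⊆p G Z) G⊆E) (⊆-trans (p─q⊆p G A) G⊆E)) ⟩
    (r Z + r A) + (r Gᶻ + r Gᴬ)
      ≡⟨ interchange +-commutativeSemigroup (r Z) (r A) (r Gᶻ) (r Gᴬ) ⟩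
    λ⁺ G Z + λ⁺ G A ∎
    where
    open ≤-Reasoning
    Gᶻ Gᴬ : Subset n
    Gᶻ = G ─ Z
    Gᴬ = G ─ A

  ∈cl-mono : ∀ {e W S} → _∈cl_ M e W → W ⊆ S → S ⊆ E → _∈cl_ M e S
  ∈cl-mono {e} {W} {S} (e∈E , rW+e≡rW) W⊆S S⊆E =
    e∈E , ≤-antisym rS+e≤rS (r-mono-⊆ (p⊆p∪q ⁅ e ⁆) S+e⊆E)
    where
    e⊆E : ⁅ e ⁆ ⊆ E
    e⊆E = x∈p⇒⁅x⁆⊆p e∈E
    S+e⊆E : S ∪ ⁅ e ⁆ ⊆ E
    S+e⊆E = ∪-lub S⊆E e⊆E
    W+e⊆E : W ∪ ⁅ e ⁆ ⊆ E
    W+e⊆E = ∪-lub (⊆-trans W⊆S S⊆E) e⊆E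
    open ≤-Reasoning
    rS+e≤rS : r (S ∪ ⁅ e ⁆) ≤ r S
    rS+e≤rS = +-cancelʳ-≤ (r W) _ _ (begin
      r (S ∪ ⁅ e ⁆) + r W
        ≤⟨ +-mono-≤ (r-mono-⊆ (∪-monoʳ-⊆ (q⊆p∪q W ⁅ e ⁆)) (∪-lub S⊆E W+e⊆E))
                    (r-mono-⊆ (λ x∈W → x∈p∩q⁺ (W⊆S x∈W , p⊆p∪q ⁅ e ⁆ x∈W))
                              (⊆-trans (p∩q⊆p S _) S⊆E)) ⟩
      r (S ∪ (W ∪ ⁅ e ⁆)) + r (S ∩ (W ∪ ⁅ e ⁆))
        ≤⟨ r-submod S (W ∪ ⁅ e ⁆) S⊆E W+e⊆E ⟩
      r S + r (W ∪ ⁅ e ⁆)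
        ≡⟨ cong (r S +_) rW+e≡rW ⟩
      r S + r W ∎)

  ∈cl[S-e]⇒rS≤r[S-e] : ∀ {e S} → S ⊆ E → _∈cl_ M e (S - e) → r S ≤ r (S - e)
  ∈cl[S-e]⇒rS≤r[S-e] {e} {S} S⊆E (e∈E , r[S-e+e]≡r[S-e]) =
    ≤-trans (r-mono-⊆ (p⊆[p─q]∪q S ⁅ e ⁆) (∪-lub (⊆-trans (p─q⊆p S ⁅ e ⁆) S⊆E) (x∈p⇒⁅x⁆⊆p e∈E)))
            (≤-reflexive r[S-e+e]≡r[S-e])

  dualRank-≥ : ∀ {W} → r E ≤ r (E ─ W) → ∣ W ∣ ≤ dualRank M W
  dualRank-≥ {W} rE≤r[E─W] = m+n≤o⇒m≤o∸n ∣ W ∣ (+-monoʳ-≤ ∣ W ∣ rE≤r[E─W])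

  dualRank-< : ∀ {W} → 1 ≤ ∣ W ∣ → r (E ─ W) < r E → dualRank M W < ∣ W ∣
  dualRank-< {W} 1≤∣W∣ r[E─W]<rE =
    m<n+o⇒m∸n<o (∣ W ∣ + r (E ─ W)) (r E) {{>-nonZero 1≤∣W∣}}
      (subst (∣ W ∣ + r (E ─ W) <_) (+-comm ∣ W ∣ (r E)) (+-monoʳ-< ∣ W ∣ r[E─W]<rE))

  module _ (3conn : ThreeConnected M) where

    3conn⇒rE+k≤λ⁺ : ∀ {k Z} → 1 ≤ k → k < 3 → Z ⊆ E → k ≤ ∣ Z ∣ → k ≤ ∣ E ─ Z ∣ →
                    r E + k ≤ λ⁺ E Z
    3conn⇒rE+k≤λ⁺ {k} {Z} 1≤k k<3 Z⊆E k≤∣Z∣ k≤∣E─Z∣ with r E + k ≤? λ⁺ E Z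
    ... | yes rE+k≤λ⁺ = rE+k≤λ⁺
    ... | no  rE+k≰λ⁺ = ⊥-elim (3conn k Z 1≤k k<3
      (Z⊆E , k≤∣Z∣ , k≤∣E─Z∣ , m<n+o⇒m∸n<o (λ⁺ E Z) (r E) {{>-nonZero 1≤k}} (≰⇒> rE+k≰λ⁺)))

    module _ (4≤∣E∣ : 4 ≤ ∣ E ∣) where

      small⇒rE+∣W∣≤λ⁺ : ∀ {W} → W ⊆ E → 1 ≤ ∣ W ∣ → ∣ W ∣ ≤ 2 → r E + ∣ W ∣ ≤ λ⁺ E W
      small⇒rE+∣W∣≤λ⁺ {W} W⊆E 1≤∣W∣ ∣W∣≤2 =
        3conn⇒rE+k≤λ⁺ 1≤∣W∣ (s≤s ∣W∣≤2) W⊆E ≤-refl (≤-trans ∣W∣≤2 2≤∣E─W∣)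
        where
        2≤∣E─W∣ : 2 ≤ ∣ E ─ W ∣
        2≤∣E─W∣ = +-cancelʳ-≤ 2 2 ∣ E ─ W ∣
          (≤-trans 4≤∣E∣ (≤-trans (∣p∣≤∣p─q∣+∣q∣ E W) (+-monoʳ-≤ ∣ E ─ W ∣ ∣W∣≤2)))

      small⇒independent : ∀ {W} → W ⊆ E → 1 ≤ ∣ W ∣ → ∣ W ∣ ≤ 2 → ∣ W ∣ ≤ r W
      small⇒independent {W} W⊆E 1≤∣W∣ ∣W∣≤2 = +-cancelˡ-≤ (r E) ∣ W ∣ (r W) (begin
        r E + ∣ W ∣       ≤⟨ small⇒rE+∣W∣≤λ⁺ W⊆E 1≤∣W∣ ∣W∣≤2 ⟩
        r W + r (E ─ W)   ≤⟨ +-monoʳ-≤ (r W) (r-mono-⊆ (p─q⊆p E W) ⊆-refl) ⟩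
        r W + r E         ≡⟨ +-comm (r W) (r E) ⟩
        r E + r W         ∎)
        where open ≤-Reasoning

      small⇒coindependent : ∀ {W} → W ⊆ E → 1 ≤ ∣ W ∣ → ∣ W ∣ ≤ 2 → r E ≤ r (E ─ W)
      small⇒coindependent {W} W⊆E 1≤∣W∣ ∣W∣≤2 = +-cancelʳ-≤ ∣ W ∣ (r E) (r (E ─ W)) (begin
        r E + ∣ W ∣       ≤⟨ small⇒rE+∣W∣≤λ⁺ W⊆E 1≤∣W∣ ∣W∣≤2 ⟩
        r W + r (E ─ W)   ≤⟨ +-monoˡ-≤ (r (E ─ W)) (r-card W W⊆E) ⟩
        ∣ W ∣ + r (E ─ W) ≡⟨ +-comm ∣ W ∣ (r (E ─ W)) ⟩
        r (E ─ W) + ∣ W ∣ ∎)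
        where open ≤-Reasoning

      nonspanning-complement⇒triad : ∀ {T} → T ⊆ E → 2 ≤ ∣ T ∣ → ∣ T ∣ ≤ 3 → r (E ─ T) < r E →
                                     Triad M T
      nonspanning-complement⇒triad {T} T⊆E 2≤∣T∣ ∣T∣≤3 r[E─T]<rE with ∣ T ∣ ≤? 2
      ... | yes ∣T∣≤2 =
        contradiction (small⇒coindependent T⊆E (≤-trans (s≤s z≤n) 2≤∣T∣) ∣T∣≤2) (<⇒≱ r[E─T]<rE)
      ... | no  ∣T∣≰2 =
        ((T⊆E , dualRank-< (≤-trans (s≤s z≤n) 2≤∣T∣) r[E─T]<rE) , minimal)
        , ≤-antisym ∣T∣≤3 (≰⇒> ∣T∣≰2)
        where
        minimal : ∀ W → W ⊂ T → ¬ DependentOn E (dualRank M) W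
        minimal W W⊂T (W⊆E , dual<∣W∣) = <⇒≱ dual<∣W∣ ∣W∣≤dual
          where
          ∣W∣≤dual : ∣ W ∣ ≤ dualRank M W
          ∣W∣≤dual with 1 ≤? ∣ W ∣
          ... | no  1≰∣W∣ = ≤-trans (≤-pred (≰⇒> 1≰∣W∣)) z≤n
          ... | yes 1≤∣W∣ = dualRank-≥ (small⇒coindependent W⊆E 1≤∣W∣
                                         (≤-pred (≤-trans (p⊂q⇒∣p∣<∣q∣ W⊂T) ∣T∣≤3)))

      module _ {e : Fin n} (e∈E : e ∈ E) where

        E-e⊆E : E - e ⊆ E
        E-e⊆E = p─q⊆p E ⁅ e ⁆

        E-e─S≡E─[S∪e] : ∀ S → E - e ─ S ≡ E ─ (S ∪ ⁅ e ⁆)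
        E-e─S≡E─[S∪e] S = trans (p─q─r≡p─q∪r E ⁅ e ⁆ S) (cong (E ─_) (∪-comm ⁅ e ⁆ S))

        -- Deleting e from E - Q costs no rank because e is spanned by W ⊆ E - Q.
        cl-disjoint⇒rE+2≤λ⁺ : ∀ {Q W} → Q ⊆ E - e → 2 ≤ ∣ Q ∣ → W ⊆ E - e ─ Q → 2 ≤ ∣ W ∣ →
                               _∈cl_ M e W → r E + 2 ≤ λ⁺ (E - e) Q
        cl-disjoint⇒rE+2≤λ⁺ {Q} {W} Q⊆E-e 2≤∣Q∣ W⊆E-e─Q 2≤∣W∣ e∈clW = begin
          r E + 2          ≤⟨ 3conn⇒rE+k≤λ⁺ (s≤s z≤n) ≤-refl (⊆-trans Q⊆E-e E-e⊆E) 2≤∣Q∣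
                                (≤-trans 2≤∣W∣ (p⊆q⇒∣p∣≤∣q∣ (⊆-trans W⊆E-e─Q E-e─Q⊆E─Q))) ⟩
          r Q + r (E ─ Q)  ≤⟨ +-monoʳ-≤ (r Q) r[E─Q]≤r[E-e─Q] ⟩
          λ⁺ (E - e) Q     ∎
          where
          open ≤-Reasoning
          E-e─Q⊆E─Q : E - e ─ Q ⊆ E ─ Q
          E-e─Q⊆E─Q = ─-monoˡ-⊆ E-e⊆E
          E-e─Q≡E─Q-e : E - e ─ Q ≡ E ─ Q - e
          E-e─Q≡E─Q-e = p─q─r≡p─r─q E ⁅ e ⁆ Q
          r[E─Q]≤r[E-e─Q] : r (E ─ Q) ≤ r (E - e ─ Q)
          r[E─Q]≤r[E-e─Q] = subst (λ Z → r (E ─ Q) ≤ r Z) (sym E-e─Q≡E─Q-e)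
            (∈cl[S-e]⇒rS≤r[S-e] (p─q⊆p E Q)
              (∈cl-mono e∈clW (subst (W ⊆_) E-e─Q≡E─Q-e W⊆E-e─Q)
                (⊆-trans (p─q⊆p _ ⁅ e ⁆) (p─q⊆p E Q))))

        ∈cl-complement : ∀ {X} → X ⊆ E - e → 2 ≤ ∣ X ∣ → 2 ≤ ∣ E - e ─ X ∣ →
                         λ⁺ E X ≤ r E + 2 → _∈cl_ M e X → _∈cl_ M e (E - e ─ X)
        ∈cl-complement {X} X⊆E-e 2≤∣X∣ 2≤∣Y∣ λ⁺X≤rE+2 (_ , r[X+e]≡rX) =
          e∈E , ≤-antisym r[Y+e]≤rY (r-mono-⊆ (p⊆p∪q ⁅ e ⁆) Y+e⊆E)
          where
          open ≤-Reasoning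
          Y : Subset n
          Y = E - e ─ X
          Y+e⊆E─X : Y ∪ ⁅ e ⁆ ⊆ E ─ X
          Y+e⊆E─X = ∪-lub (─-monoˡ-⊆ E-e⊆E)
            (x∈p⇒⁅x⁆⊆p (x∈p∧x∉q⇒x∈p─q e∈E (p⊆q-x⇒x∉p X⊆E-e)))
          Y+e⊆E : Y ∪ ⁅ e ⁆ ⊆ E
          Y+e⊆E = ⊆-trans Y+e⊆E─X (p─q⊆p E X)
          rE+2≤rX+rY : r E + 2 ≤ r X + r Y
          rE+2≤rX+rY = begin
            r E + 2
              ≤⟨ 3conn⇒rE+k≤λ⁺ (s≤s z≤n) ≤-refl (∪-lub (⊆-trans X⊆E-e E-e⊆E) (x∈p⇒⁅x⁆⊆p e∈E))
                   (≤-trans 2≤∣X∣ (∣p∣≤∣p∪q∣ X ⁅ e ⁆))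
                   (subst (λ Z → 2 ≤ ∣ Z ∣) (E-e─S≡E─[S∪e] X) 2≤∣Y∣) ⟩
            r (X ∪ ⁅ e ⁆) + r (E ─ (X ∪ ⁅ e ⁆))
              ≡⟨ cong₂ _+_ r[X+e]≡rX (cong r (sym (E-e─S≡E─[S∪e] X))) ⟩
            r X + r Y
              ∎
          r[Y+e]≤rY : r (Y ∪ ⁅ e ⁆) ≤ r Y
          r[Y+e]≤rY = +-cancelˡ-≤ (r X) _ _ (begin
            r X + r (Y ∪ ⁅ e ⁆)  ≤⟨ +-monoʳ-≤ (r X) (r-mono-⊆ Y+e⊆E─X (p─q⊆p E X)) ⟩
            λ⁺ E X               ≤⟨ λ⁺X≤rE+2 ⟩
            r E + 2              ≤⟨ rE+2≤rX+rY ⟩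
            r X + r Y            ∎)

        opposite-quadrant≤1 : ∀ {P P′ A} → P ⊆ E - e → P′ ⊆ E - e ─ P → A ⊆ E - e →
          2 ≤ ∣ P ∣ → 2 ≤ ∣ P′ ∣ → _∈cl_ M e P → _∈cl_ M e P′ →
          λ⁺ (E - e) P ≤ r E + 2 → λ⁺ (E - e) A < r E + 2 →
          ∣ A ∩ P ∣ ≤ 1 ⊎ ∣ (E - e ─ A) ∩ (E - e ─ P) ∣ ≤ 1
        opposite-quadrant≤1 {P} {P′} {A} P⊆E-e P′⊆E-e─P A⊆E-e 2≤∣P∣ 2≤∣P′∣ e∈clP e∈clP′ λ⁺P≤ λ⁺A<
          with ∣ A ∩ P ∣ ≤? 1 | ∣ (E - e ─ A) ∩ (E - e ─ P) ∣ ≤? 1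
        ... | yes small | _         = inj₁ small
        ... | no  _     | yes small = inj₂ small
        ... | no  big   | no  big′  = ⊥-elim (<⇒≱ uncrossed (+-mono-≤ inner outer))
          where
          open ≤-Reasoning
          A∩P⊆E-e : A ∩ P ⊆ E - e
          A∩P⊆E-e = ⊆-trans (p∩q⊆q A P) P⊆E-e
          inner : r E + 2 ≤ λ⁺ (E - e) (A ∩ P)
          inner = cl-disjoint⇒rE+2≤λ⁺ A∩P⊆E-e (≰⇒> big)
                    (⊆-trans P′⊆E-e─P (─-monoʳ-⊆ (p∩q⊆q A P))) 2≤∣P′∣ e∈clP′
          outer : r E + 2 ≤ λ⁺ (E - e) (A ∪ P)
          outer = begin
            r E + 2
              ≤⟨ cl-disjoint⇒rE+2≤λ⁺ (⊆-trans (p∩q⊆q _ _) (p─q⊆p (E - e) P)) (≰⇒> big′)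
                   P⊆E-e─B∩P′ 2≤∣P∣ e∈clP ⟩
            λ⁺ (E - e) ((E - e ─ A) ∩ (E - e ─ P))
              ≡⟨ cong (λ⁺ (E - e)) (p─[q∪t]≡[p─q]∩[p─t] (E - e) A P) ⟨
            λ⁺ (E - e) (E - e ─ (A ∪ P))
              ≡⟨ λ⁺-complement (∪-lub A⊆E-e P⊆E-e) ⟩
            λ⁺ (E - e) (A ∪ P)
              ∎
            where
            P⊆E-e─B∩P′ : P ⊆ E - e ─ (E - e ─ A) ∩ (E - e ─ P)
            P⊆E-e─B∩P′ = subst (_⊆ E - e ─ (E - e ─ A) ∩ (E - e ─ P)) (p─[p─q]≡q P⊆E-e)
                           (─-monoʳ-⊆ (p∩q⊆q _ _))
          uncrossed : λ⁺ (E - e) (A ∩ P) + λ⁺ (E - e) (A ∪ P) < (r E + 2) + (r E + 2)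
          uncrossed = begin-strict
            λ⁺ (E - e) (A ∩ P) + λ⁺ (E - e) (A ∪ P)  ≤⟨ λ⁺-uncross E-e⊆E A⊆E-e P⊆E-e ⟩
            λ⁺ (E - e) A + λ⁺ (E - e) P              <⟨ +-mono-<-≤ λ⁺A< λ⁺P≤ ⟩
            (r E + 2) + (r E + 2)                    ∎

        small-side⇒triad : ∀ {S k} → S ⊆ E - e → 1 ≤ k → k ≤ ∣ S ∣ → ∣ S ∣ ≤ 2 →
                           λ⁺ (E - e) S < r E + k → Triad M (S ∪ ⁅ e ⁆)
        small-side⇒triad {S} {k} S⊆E-e 1≤k k≤∣S∣ ∣S∣≤2 λ⁺S<rE+k =
          nonspanning-complement⇒triad (∪-lub S⊆E (x∈p⇒⁅x⁆⊆p e∈E)) 2≤∣S+e∣ ∣S+e∣≤3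
            (subst (λ Z → r Z < r E) (E-e─S≡E─[S∪e] S) r[E-e─S]<rE)
          where
          open ≤-Reasoning
          S⊆E : S ⊆ E
          S⊆E = ⊆-trans S⊆E-e E-e⊆E
          S⊂S+e : S ⊂ S ∪ ⁅ e ⁆
          S⊂S+e = p⊆p∪q ⁅ e ⁆ , e , q⊆p∪q S ⁅ e ⁆ (x∈⁅x⁆ e) , p⊆q-x⇒x∉p S⊆E-e
          2≤∣S+e∣ : 2 ≤ ∣ S ∪ ⁅ e ⁆ ∣
          2≤∣S+e∣ = ≤-trans (s≤s (≤-trans 1≤k k≤∣S∣)) (p⊂q⇒∣p∣<∣q∣ S⊂S+e)
          ∣S+e∣≤3 : ∣ S ∪ ⁅ e ⁆ ∣ ≤ 3
          ∣S+e∣≤3 = begin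
            ∣ S ∪ ⁅ e ⁆ ∣      ≤⟨ ∣p∪q∣≤∣p∣+∣q∣ S ⁅ e ⁆ ⟩
            ∣ S ∣ + ∣ ⁅ e ⁆ ∣  ≡⟨ cong (∣ S ∣ +_) (∣⁅x⁆∣≡1 e) ⟩
            ∣ S ∣ + 1          ≤⟨ +-monoˡ-≤ 1 ∣S∣≤2 ⟩
            3                  ∎
          r[E-e─S]<rE : r (E - e ─ S) < r E
          r[E-e─S]<rE = +-cancelˡ-< (r S) _ _ (begin-strict
            λ⁺ (E - e) S  <⟨ λ⁺S<rE+k ⟩
            r E + k       ≤⟨ +-monoʳ-≤ (r E)
                               (≤-trans k≤∣S∣ (small⇒independent S⊆E (≤-trans 1≤k k≤∣S∣) ∣S∣≤2)) ⟩
            r E + r S     ≡⟨ +-comm (r E) (r S) ⟩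
            r S + r E     ∎)

        module _ {X} (X⊆E-e : X ⊆ E - e) (3≤∣X∣ : 3 ≤ ∣ X ∣) (3≤∣Y∣ : 3 ≤ ∣ E - e ─ X ∣)
                 (e∈clX : _∈cl_ M e X) (e∈clY : _∈cl_ M e (E - e ─ X))
                 (λ⁺X≤rE+2 : λ⁺ (E - e) X ≤ r E + 2) where

          small-side : ∀ {A} → A ⊆ E - e → λ⁺ (E - e) A < r E + 2 → ∣ A ∣ ≤ 2 ⊎ ∣ E - e ─ A ∣ ≤ 2
          small-side {A} A⊆E-e λ⁺A<rE+2 = combine viaX viaY
            where
            Y B : Subset n
            Y = E - e ─ X
            B = E - e ─ A
            Y⊆E-e : Y ⊆ E - e
            Y⊆E-e = p─q⊆p (E - e) X
            E-e─Y≡X : E - e ─ Y ≡ X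
            E-e─Y≡X = p─[p─q]≡q X⊆E-e
            2≤∣X∣ : 2 ≤ ∣ X ∣
            2≤∣X∣ = ≤-trans (n≤1+n 2) 3≤∣X∣
            2≤∣Y∣ : 2 ≤ ∣ Y ∣
            2≤∣Y∣ = ≤-trans (n≤1+n 2) 3≤∣Y∣
            viaX : ∣ A ∩ X ∣ ≤ 1 ⊎ ∣ B ∩ Y ∣ ≤ 1
            viaX = opposite-quadrant≤1 X⊆E-e ⊆-refl A⊆E-e 2≤∣X∣ 2≤∣Y∣ e∈clX e∈clY λ⁺X≤rE+2 λ⁺A<rE+2
            viaY : ∣ A ∩ Y ∣ ≤ 1 ⊎ ∣ B ∩ X ∣ ≤ 1
            viaY = map₂ (subst (λ Z → ∣ B ∩ Z ∣ ≤ 1) E-e─Y≡X)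
              (opposite-quadrant≤1 Y⊆E-e (subst (X ⊆_) (sym E-e─Y≡X) ⊆-refl) A⊆E-e
                 2≤∣Y∣ 2≤∣X∣ e∈clY e∈clX
                (subst (_≤ r E + 2) (sym (λ⁺-complement X⊆E-e)) λ⁺X≤rE+2) λ⁺A<rE+2)
            two-quadrants : ∀ {S} U → S ⊆ E - e → ∣ S ∩ U ∣ ≤ 1 → ∣ S ∩ (E - e ─ U) ∣ ≤ 1 →
                            ∣ S ∣ ≤ 2
            two-quadrants U S⊆E-e S∩U≤1 S∩U′≤1 =
              ≤-trans (∣p∣≤∣p∩q∣+∣p∩[t─q]∣ S⊆E-e) (+-mono-≤ S∩U≤1 S∩U′≤1)
            swap : ∀ S U → ∣ S ∩ U ∣ ≤ 1 → ∣ U ∩ S ∣ ≤ 1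
            swap S U = subst (λ Z → ∣ Z ∣ ≤ 1) (∩-comm S U)
            combine : ∣ A ∩ X ∣ ≤ 1 ⊎ ∣ B ∩ Y ∣ ≤ 1 → ∣ A ∩ Y ∣ ≤ 1 ⊎ ∣ B ∩ X ∣ ≤ 1 →
                      ∣ A ∣ ≤ 2 ⊎ ∣ B ∣ ≤ 2
            combine (inj₁ A∩X) (inj₁ A∩Y) = inj₁ (two-quadrants X A⊆E-e A∩X A∩Y)
            combine (inj₂ B∩Y) (inj₂ B∩X) = inj₂ (two-quadrants X (p─q⊆p (E - e) A) B∩X B∩Y)
            combine (inj₁ A∩X) (inj₂ B∩X) =
              contradiction (two-quadrants A X⊆E-e (swap A X A∩X) (swap B X B∩X)) (<⇒≱ 3≤∣X∣)
            combine (inj₂ B∩Y) (inj₁ A∩Y) =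
              contradiction (two-quadrants A Y⊆E-e (swap A Y A∩Y) (swap B Y B∩Y)) (<⇒≱ 3≤∣Y∣)

          separation⇒triad : ∀ {k A} → 1 ≤ k → k < 3 → IsSeparation (E - e) r k A →
                             ∃[ T ] (Triad M T × e ∈ T)
          separation⇒triad {k} {A} 1≤k k<3 (A⊆E-e , k≤∣A∣ , k≤∣B∣ , conn<k) =
            [ (λ ∣A∣≤2 → A ∪ ⁅ e ⁆ , small-side⇒triad A⊆E-e 1≤k k≤∣A∣ ∣A∣≤2 λ⁺A<rE+k , e∈S+e A)
            , (λ ∣B∣≤2 → (E - e ─ A) ∪ ⁅ e ⁆
                       , small-side⇒triad (p─q⊆p (E - e) A) 1≤k k≤∣B∣ ∣B∣≤2
                           (subst (_< r E + k) (sym (λ⁺-complement A⊆E-e)) λ⁺A<rE+k)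
                       , e∈S+e (E - e ─ A))
            ]′ (small-side A⊆E-e (<-≤-trans λ⁺A<rE+k (+-monoʳ-≤ (r E) (≤-pred k<3))))
            where
            open ≤-Reasoning
            e∈S+e : ∀ S → e ∈ S ∪ ⁅ e ⁆
            e∈S+e S = q⊆p∪q S ⁅ e ⁆ (x∈⁅x⁆ e)
            λ⁺A<rE+k : λ⁺ (E - e) A < r E + k
            λ⁺A<rE+k = begin-strict
              λ⁺ (E - e) A                       ≤⟨ λ⁺≤r+conn (E - e) A ⟩
              r (E - e) + conn (E - e) r A       <⟨ +-monoʳ-< (r (E - e)) conn<k ⟩
              r (E - e) + k                      ≤⟨ +-monoˡ-≤ k (r-mono-⊆ E-e⊆E ⊆-refl) ⟩
              r E + k                            ∎

lemma5p1 : {n : ℕ} (M : Matroid n) → ThreeConnected M →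
    (X : Subset n) → X ⊆ Matroid.E M → λM M X ≡ 2 → 3 ≤ ∣ X ∣ →
    ∣ X ∣ + 4 ≤ ∣ Matroid.E M ∣ →
    (e : Fin n) → _∈cl_ M e X → e ∉ X →
    (∃[ T ] (Triad M T × e ∈ T)) ⊎ DeletionThreeConnected M e
lemma5p1 M 3conn X X⊆E λX≡2 3≤∣X∣ ∣X∣+4≤∣E∣ e e∈clX@(e∈E , _) e∉X =
  map₁ (λ (_ , _ , 1≤k , k<3 , sep) →
         separation⇒triad M 3conn 4≤∣E∣ e∈E X⊆E-e 3≤∣X∣ 3≤∣Y∣ e∈clX e∈clY λ⁺X≤rE+2 1≤k k<3 sep)
       (separation⊎threeConnected (E - e) r)
  where
  open Matroid M
  4≤∣E∣ : 4 ≤ ∣ E ∣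
  4≤∣E∣ = ≤-trans (m≤n+m 4 ∣ X ∣) ∣X∣+4≤∣E∣
  X⊆E-e : X ⊆ E - e
  X⊆E-e = p⊆q∧x∉p⇒p⊆q-x X⊆E e∉X
  3≤∣Y∣ : 3 ≤ ∣ E - e ─ X ∣
  3≤∣Y∣ = ∣q∣+[1+k]≤∣p∣⇒k≤∣p-x─q∣ E X e ∣X∣+4≤∣E∣
  λ⁺EX≤rE+2 : λ⁺ M E X ≤ r E + 2
  λ⁺EX≤rE+2 = subst (λ c → λ⁺ M E X ≤ r E + c) λX≡2 (λ⁺≤r+conn M E X)
  λ⁺X≤rE+2 : λ⁺ M (E - e) X ≤ r E + 2
  λ⁺X≤rE+2 = ≤-trans (λ⁺-monoˡ M X (p─q⊆p E ⁅ e ⁆) ⊆-refl) λ⁺EX≤rE+2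
  e∈clY : _∈cl_ M e (E - e ─ X)
  e∈clY = ∈cl-complement M 3conn 4≤∣E∣ e∈E X⊆E-e (≤-trans (n≤1+n 2) 3≤∣X∣) (≤-trans (n≤1+n 2) 3≤∣Y∣)
            λ⁺EX≤rE+2 e∈clX
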